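{- $\mathfrak{b}\le\mathfrak{x}_{\le,\le}\le\mathfrak{x}_{\le,<}\le\mathfrak{x}_{<,\le}\le\mathfrak{x}_{<,<}\le\mathfrak{d}$.
   Context: $\mathbb{N}^{\mathbb{N}}$ is the set of functions $\mathbb{N}\to\mathbb{N}$; $f\le^* g$ means $f(n)\le g(n)$ for all but finitely many $n$. $\mathfrak{b}$ is the minimal size of a subset of $\mathbb{N}^{\mathbb{N}}$ unbounded with respect to $\le^*$, and $\mathfrak{d}$ is the minimal size of a subset of $\mathbb{N}^{\mathbb{N}}$ cofinal with respect to $\le^*$ (dominating). For $f,g\in\mathbb{N}^{\mathbb{N}}$ and a binary relation $R$ on $\mathbb{N}$, $[f R g]=\{n: f(n)Rg(n)\}$. For $R,S\in\{\le,<\}$, $X\subseteq\mathbb{N}^{\mathbb{N}}$ and $g\in\mathbb{N}^{\mathbb{N}}$, $g$ avoids middles in $X$ with respect to $\langle R,S\rangle$ if (1) for each $f\in X$ the set $[fRg]$ is infinite, and (2) for all $f,h\in X$ at least one of the sets $\{n: f(n)Rg(n)\text{ and }g(n)Sh(n)\}$ and $\{n: h(n)Rg(n)\text{ and }g(n)Sf(n)\}$ is finite. $X$ satisfies the excluded middle property with respect to $\langle R,S\rangle$ if some $g\in\mathbb{N}^{\mathbb{N}}$ avoids middles in $X$ with respect to $\langle R,S\rangle$. $\mathfrak{x}_{R,S}$ is the minimal size of a subset of $\mathbb{N}^{\mathbb{N}}$ which does not satisfy the excluded middle property with respect to $\langle R,S\rangle$. -}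

module Defs where

open import Data.Nat using (ℕ; _≤_; _<_)
open import Data.Product using (Σ; ∃; _×_; _,_)
open import Data.Sum using (_⊎_)
open import Relation.Nullary using (¬_)
open import Relation.Binary.PropositionalEquality using (_≡_)
open import Function.Bundles using (_↣_)

Baire : Set
Baire = ℕ → ℕ

Infinite : (ℕ → Set) → Set
Infinite A = ∀ n → Σ ℕ λ m → n ≤ m × A m

Finite : (ℕ → Set) → Set
Finite A = Σ ℕ λ n → ∀ m → n ≤ m → ¬ A m

_≤*_ : Baire → Baire → Set
f ≤* g = Σ ℕ λ N → ∀ n → N ≤ n → f n ≤ g n

-- A subset X of ℕ^ℕ, presented as an injectively indexed family
-- (injective w.r.t. pointwise equality of functions), so that the
-- cardinality of X is the cardinality of the index type Idx.
record Family : Set₁ where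
  field
    Idx : Set
    elt : Idx → Baire
    inj : ∀ i j → (∀ n → elt i n ≡ elt j n) → i ≡ j
open Family public

AvoidsMiddles : (R S : ℕ → ℕ → Set) → Family → Baire → Set
AvoidsMiddles R S X g =
  (∀ i → Infinite (λ n → R (elt X i n) (g n))) ×
  (∀ i j →
     Finite (λ n → R (elt X i n) (g n) × S (g n) (elt X j n)) ⊎
     Finite (λ n → R (elt X j n) (g n) × S (g n) (elt X i n)))

ExcludedMiddle : (R S : ℕ → ℕ → Set) → Family → Set
ExcludedMiddle R S X = Σ Baire λ g → AvoidsMiddles R S X g

NotExcludedMiddle : (R S : ℕ → ℕ → Set) → Family → Set
NotExcludedMiddle R S X = ¬ ExcludedMiddle R S X

Unbounded : Family → Set
Unbounded X = ¬ (Σ Baire λ g → ∀ i → elt X i ≤* g)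

Dominating : Family → Set
Dominating X = ∀ (h : Baire) → Σ (Idx X) λ i → h ≤* elt X i

-- Comparison of cardinal characteristics given as
--   𝔭 = min{|X| : P X},  𝔮 = min{|X| : Q X}.
-- 𝔭 ≤ 𝔮 holds iff every Q-witness X admits a P-witness Y with |Y| ≤ |X|
-- (cardinality comparison via an injection of index types).
_≼_ : (Family → Set) → (Family → Set) → Set₁
P ≼ Q = ∀ (X : Family) → Q X → Σ Family λ Y → P Y × (Idx Y ↣ Idx X)

infix 4 _≼_

-- An eventual bound g of X gives g + 1, which lies above every member of X eventually and so
-- avoids middles for ⟨≤,≤⟩; conversely, a dominating member eventually above g already
-- defeats the first clause for R = <. The middle inequalities are monotonicity in S, except
-- ⟨≤,<⟩ versus ⟨<,≤⟩, which is a shift of X by one.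
module Submission where

open import Defs
open import Data.Nat using (ℕ; suc; _≤_; _<_; _+_; s≤s)
open import Data.Nat.Properties using (m≤m+n; m≤n+m; m≤n⇒m≤1+n; <⇒≤; ≤⇒≯; suc-injective)
open import Data.Product using (_×_; _,_)
open import Data.Sum using (inj₁) renaming (map to ⊎-map)
open import Function.Base using (_∘_)
open import Function.Construct.Identity using (↣-id)
open import Relation.Nullary using (¬_)
open import Relation.Binary.Core using (Rel; _⇒_)
open import Level using (0ℓ)

Finite-⊆ : {A B : ℕ → Set} → (∀ {m} → B m → A m) → Finite A → Finite B
Finite-⊆ B⊆A (N , notA) = N , λ m N≤m → notA m N≤m ∘ B⊆A

Infinite-⊆ : {A B : ℕ → Set} → (∀ {m} → A m → B m) → Infinite A → Infinite B
Infinite-⊆ A⊆B inf n with inf n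
... | m , n≤m , a = m , n≤m , A⊆B a

Finite⇒¬Infinite : {A : ℕ → Set} → Finite A → ¬ Infinite A
Finite⇒¬Infinite (N , notA) inf with inf N
... | m , N≤m , a = notA m N≤m a

≤*⇒Infinite-≤ : {f g : Baire} → f ≤* g → Infinite (λ n → f n ≤ g n)
≤*⇒Infinite-≤ (N , f≤g) n = n + N , m≤m+n n N , f≤g (n + N) (m≤n+m N n)

≤*⇒Finite-> : {f g : Baire} → f ≤* g → Finite (λ n → g n < f n)
≤*⇒Finite-> (N , f≤g) = N , λ m N≤m → ≤⇒≯ (f≤g m N≤m)

≼-of-⇒ : {P Q : Family → Set} → (∀ X → Q X → P X) → P ≼ Q
≼-of-⇒ Q⇒P X q = X , Q⇒P X q , ↣-id (Idx X)

AvoidsMiddles-antitoneʳ : ∀ R (S S′ : Rel ℕ 0ℓ) → S ⇒ S′ →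
                          ∀ X g → AvoidsMiddles R S′ X g → AvoidsMiddles R S X g
AvoidsMiddles-antitoneʳ R S S′ S⊆S′ X g (infinite , excluded) =
  infinite , λ i j → ⊎-map (Finite-⊆ weaken) (Finite-⊆ weaken) (excluded i j)
  where
  weaken : ∀ {a b c} → R a b × S b c → R a b × S′ b c
  weaken (r , s) = r , S⊆S′ s

NotExcludedMiddle-monoʳ : ∀ R (S S′ : Rel ℕ 0ℓ) → S ⇒ S′ →
                          ∀ X → NotExcludedMiddle R S X → NotExcludedMiddle R S′ X
NotExcludedMiddle-monoʳ R S S′ S⊆S′ X ¬em (g , avoids) =
  ¬em (g , AvoidsMiddles-antitoneʳ R S S′ S⊆S′ X g avoids)

sucFamily : Family → Family
sucFamily X = record
  { Idx = Idx X
  ; elt = λ i → suc ∘ elt X i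
  ; inj = λ i j eq → inj X i j (suc-injective ∘ eq)
  }

-- x + 1 ≤ y is x < y and y < x + 1 is y ≤ x, so shifting X by one trades ⟨≤,<⟩ for ⟨<,≤⟩.
AvoidsMiddles-sucFamily : ∀ {X g} → AvoidsMiddles _≤_ _<_ (sucFamily X) g → AvoidsMiddles _<_ _≤_ X g
AvoidsMiddles-sucFamily {X} {g} = AvoidsMiddles-antitoneʳ _<_ _≤_ (λ a b → a < suc b) s≤s X g

NotExcludedMiddle-sucFamily : ∀ X → NotExcludedMiddle _<_ _≤_ X → NotExcludedMiddle _≤_ _<_ (sucFamily X)
NotExcludedMiddle-sucFamily X ¬em (g , avoids) = ¬em (g , AvoidsMiddles-sucFamily {X} avoids)

bounded⇒AvoidsMiddles : ∀ {X g} → (∀ i → elt X i ≤* g) → AvoidsMiddles _≤_ _≤_ X (suc ∘ g)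
bounded⇒AvoidsMiddles bounded =
    (λ i → Infinite-⊆ m≤n⇒m≤1+n (≤*⇒Infinite-≤ (bounded i)))
  , (λ i j → inj₁ (Finite-⊆ (λ (_ , g<xⱼ) → g<xⱼ) (≤*⇒Finite-> (bounded j))))

NotExcludedMiddle⇒Unbounded : ∀ X → NotExcludedMiddle _≤_ _≤_ X → Unbounded X
NotExcludedMiddle⇒Unbounded X ¬em (g , bounded) = ¬em (suc ∘ g , bounded⇒AvoidsMiddles {X} bounded)

Dominating⇒NotExcludedMiddle : ∀ S X → Dominating X → NotExcludedMiddle _<_ S X
Dominating⇒NotExcludedMiddle S X dominating (g , infinite , _) with dominating g
... | i , g≤*xᵢ = Finite⇒¬Infinite (≤*⇒Finite-> g≤*xᵢ) (infinite i)

lemma3p1 : (Unbounded ≼ NotExcludedMiddle _≤_ _≤_)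
         × (NotExcludedMiddle _≤_ _≤_ ≼ NotExcludedMiddle _≤_ _<_)
         × (NotExcludedMiddle _≤_ _<_ ≼ NotExcludedMiddle _<_ _≤_)
         × (NotExcludedMiddle _<_ _≤_ ≼ NotExcludedMiddle _<_ _<_)
         × (NotExcludedMiddle _<_ _<_ ≼ Dominating)
lemma3p1 =
    ≼-of-⇒ NotExcludedMiddle⇒Unbounded
  , ≼-of-⇒ (NotExcludedMiddle-monoʳ _≤_ _<_ _≤_ <⇒≤)
  , (λ X ¬em → sucFamily X , NotExcludedMiddle-sucFamily X ¬em , ↣-id (Idx X))
  , ≼-of-⇒ (NotExcludedMiddle-monoʳ _<_ _<_ _≤_ <⇒≤)
  , ≼-of-⇒ (Dominating⇒NotExcludedMiddle _<_)
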